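{- Let $\mathcal{A}$ be a $T$-shaped tree automaton and let $\mu$ be a 0/1-vector that is a solution to $\mathfrak{L}_{\mathcal{A}}$. Then there is a term $\tau\in\mathcal{L}(\mathcal{A})$ and an accepting trace $\rho$ for $\tau$ in $\mathcal{A}$ such that $\mu=\hat\rho$.
   Context: An addressed tree $T$ is a rooted tree with node set $N(T)$, root $r$, children of each node numbered $1,\dots,s$; $\mathrm{par}(u)$ denotes the parent of $u\ne r$. $\Sigma$ is a finite alphabet; a $T$-shaped term is a map $\tau:N(T)\to\Sigma$. A $T$-shaped tree automaton $\mathcal{A}=(\Sigma,Q,F,\Delta)$ has states $Q$ partitioned into cells $\{Q_u\}_{u\in N(T)}$, final states $F\subseteq Q_r$, and transitions $\Delta$ partitioned into $\{\Delta_u\}$ with $\Delta_u\subseteq Q_{u_1}\times\dots\times Q_{u_s}\times\Sigma\times Q_u$ ($u_1,\dots,u_s$ the children of $u$ in order). A trace for $\tau$ is $\rho:N(T)\to Q$ with $(\rho(u_1),\dots,\rho(u_s),\tau(u),\rho(u))\in\Delta_u$ for every $u$; it is accepting if $\rho(r)\in F$; $\mathcal{L}(\mathcal{A})$ is the set of terms with an accepting trace. For $\delta=(q_1,\dots,q_s,a,q)$ let $\mathrm{cnq}(\delta)=q$, $\mathrm{ant}(\delta)=\{q_1,\dots,q_s\}$, $\mathrm{symb}(\delta)=a$. Variables $\mathrm{var}(\mathcal{A})$: $x_{u,a}$ ($u\in N(T),a\in\Sigma$), $y_{u,q}$ ($q\in Q_u$), $z_{u,\delta}$ ($\delta\in\Delta_u$).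 The system $\mathfrak{L}_{\mathcal{A}}$: (i) all variables in $[0,1]$; (ii) $\sum_{q\in F}y_{r,q}=1$; (iii) $y_{r,q}=0$ for $q\in Q_r\setminus F$; (iv) for all $u$, $q\in Q_u$: $\sum_{\delta\in\Delta_u,\mathrm{cnq}(\delta)=q}z_{u,\delta}=y_{u,q}$; (v) for all $u\ne r$, $q\in Q_u$: $\sum_{\delta\in\Delta_{\mathrm{par}(u)},q\in\mathrm{ant}(\delta)}z_{\mathrm{par}(u),\delta}=y_{u,q}$; (vi) for all $u$, $a\in\Sigma$: $\sum_{\delta\in\Delta_u,\mathrm{symb}(\delta)=a}z_{u,\delta}=x_{u,a}$. For a trace $\rho$ for $\tau$, $\hat\rho$ is the 0/1 vector over $\mathrm{var}(\mathcal{A})$ with $\hat\rho(x_{u,a})=1$ iff $\tau(u)=a$; $\hat\rho(y_{u,q})=1$ iff $\rho(u)=q$; $\hat\rho(z_{u,\delta})=1$ iff $\delta=(\rho(u_1),\dots,\rho(u_s),\tau(u),\rho(u))$. -}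

module Defs where

open import Data.Nat using (ℕ; zero; suc; _+_; _≤_)
open import Data.Fin using (Fin; zero; suc; _≟_)
open import Data.Fin.Subset using (Subset; _∈_; _∉_)
open import Data.Fin.Subset.Properties using (_∈?_)
open import Data.Fin.Properties using (all?)
open import Data.Product using (Σ; ∃-syntax; _×_; _,_)
open import Relation.Nullary using (Dec; yes; no; ¬_)
open import Relation.Nullary.Decidable using (_×-dec_)
open import Relation.Binary.PropositionalEquality using (_≡_)

data Tree : Set where
  node : (s : ℕ) → (Fin s → Tree) → Tree

data Node : Tree → Set where
  root : ∀ {t} → Node t
  sub  : ∀ {s ch} (i : Fin s) → Node (ch i) → Node (node s ch)

arity : ∀ {t} → Node t → ℕ
arity {node s ch} root = s
arity (sub i v) = arity v

-- child u i  is the (i+1)-th child u_{i+1} of u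
child : ∀ {t} (u : Node t) → Fin (arity u) → Node t
child {node s ch} root i = sub i root
child (sub j v) i = sub j (child v i)

∑ : (n : ℕ) → (Fin n → ℕ) → ℕ
∑ zero    f = 0
∑ (suc n) f = f zero + ∑ n (λ i → f (suc i))

[_]·_ : ∀ {p} {P : Set p} → Dec P → ℕ → ℕ
[ yes _ ]· n = n
[ no  _ ]· n = 0

-- T-shaped tree automata over the alphabet Σ = Fin nΣ.
-- The cell Q_u is Fin (nQ u); Q is the disjoint union of the cells.

module _ (T : Tree) (nΣ : ℕ) (nQ : Node T → ℕ) where

  -- an element (q_1,…,q_s,a,q) of Q_{u_1}×…×Q_{u_s}×Σ×Q_u
  record Transition (u : Node T) : Set where
    constructor mkTr
    field
      ant  : (i : Fin (arity u)) → Fin (nQ (child u i))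
      symb : Fin nΣ
      cnq  : Fin (nQ u)

  _≈ᵗ_ : ∀ {u} → Transition u → Transition u → Set
  δ ≈ᵗ δ' = ((i : _) → Transition.ant δ i ≡ Transition.ant δ' i)
          × (Transition.symb δ ≡ Transition.symb δ')
          × (Transition.cnq δ ≡ Transition.cnq δ')

  _≈ᵗ?_ : ∀ {u} (δ δ' : Transition u) → Dec (δ ≈ᵗ δ')
  δ ≈ᵗ? δ' = all? (λ i → Transition.ant δ i ≟ Transition.ant δ' i)
             ×-dec ((Transition.symb δ ≟ Transition.symb δ')
             ×-dec (Transition.cnq δ ≟ Transition.cnq δ'))

record TreeAutomaton (T : Tree) (nΣ : ℕ) : Set where
  field
    nQ    : Node T → ℕ
    F     : Subset (nQ root)
    nΔ    : Node T → ℕ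
    trans : (u : Node T) → Fin (nΔ u) → Transition T nΣ nQ u
    -- Δ_u is a set: the enumeration has no repetitions
    trans-inj : ∀ u (d d' : Fin (nΔ u)) →
                _≈ᵗ_ T nΣ nQ (trans u d) (trans u d') → d ≡ d'

module _ {T : Tree} {nΣ : ℕ} (A : TreeAutomaton T nΣ) where
  open TreeAutomaton A

  Term : Set
  Term = Node T → Fin nΣ

  TraceMap : Set
  TraceMap = (u : Node T) → Fin (nQ u)

  tupleAt : Term → TraceMap → (u : Node T) → Transition T nΣ nQ u
  tupleAt τ ρ u = mkTr (λ i → ρ (child u i)) (τ u) (ρ u)

  _∈Δ_ : ∀ {u} → Transition T nΣ nQ u → Node T → Set
  _∈Δ_ {u} δ _ = ∃[ d ] _≈ᵗ_ T nΣ nQ (trans u d) δ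

  IsTrace : Term → TraceMap → Set
  IsTrace τ ρ = ∀ u → tupleAt τ ρ u ∈Δ u

  Accepting : TraceMap → Set
  Accepting ρ = ρ root ∈ F

  InLanguage : Term → Set
  InLanguage τ = ∃[ ρ ] (IsTrace τ ρ × Accepting ρ)

  -- vectors over var(A) = {x_{u,a}} ∪ {y_{u,q}} ∪ {z_{u,δ}}
  record VarVec : Set where
    constructor vv
    field
      x : (u : Node T) → Fin nΣ → ℕ
      y : (u : Node T) → Fin (nQ u) → ℕ
      z : (u : Node T) → Fin (nΔ u) → ℕ

  _≐_ : VarVec → VarVec → Set
  μ ≐ ν = (∀ u a → VarVec.x μ u a ≡ VarVec.x ν u a)
        × (∀ u q → VarVec.y μ u q ≡ VarVec.y ν u q)
        × (∀ u d → VarVec.z μ u d ≡ VarVec.z ν u d)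

  ZeroOne : VarVec → Set
  ZeroOne μ = (∀ u a → VarVec.x μ u a ≤ 1)
            × (∀ u q → VarVec.y μ u q ≤ 1)
            × (∀ u d → VarVec.z μ u d ≤ 1)

  hat : Term → TraceMap → VarVec
  hat τ ρ = vv (λ u a → [ τ u ≟ a ]· 1)
               (λ u q → [ ρ u ≟ q ]· 1)
               (λ u d → [ _≈ᵗ?_ T nΣ nQ (trans u d) (tupleAt τ ρ u) ]· 1)

  -- the system 𝔏_A, for vectors with entries in ℕ (condition (i) is
  -- imposed separately; for 0/1-vectors it holds automatically)
  record Solves (μ : VarVec) : Set where
    open VarVec μ
    field
      c-i   : ZeroOne μ
      c-ii  : ∑ (nQ root) (λ q → [ q ∈? F ]· y root q) ≡ 1
      c-iii : ∀ q → q ∉ F → y root q ≡ 0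
      c-iv  : ∀ u q →
              ∑ (nΔ u) (λ d → [ Transition.cnq (trans u d) ≟ q ]· z u d) ≡ y u q
      -- (v) for u = u_i the i-th child of p = par(u), q ∈ Q_u:
      --     ∑_{δ∈Δ_p, q∈ant δ} z_{p,δ} = y_{u,q}
      c-v   : ∀ p i q →
              ∑ (nΔ p) (λ d → [ Transition.ant (trans p d) i ≟ q ]· z p d)
                ≡ y (child p i) q
      c-vi  : ∀ u a →
              ∑ (nΔ u) (λ d → [ Transition.symb (trans u d) ≟ a ]· z u d) ≡ x u a

-- A 0/1 solution picks, at every node u, exactly one state ρ(u) and exactly one
-- transition δ_u: at the root by (ii)–(iii), and further down because (iv) and (v)
-- carry "the y-values sum to 1" from a node to its z-values and on to the y-values
-- of each child. Since z_u is then a point mass at δ_u, its sums over the fibres of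
-- cnq, ant_i and symb are point masses at the corresponding components of δ_u, so
-- (iv), (v), (vi) say cnq δ_u = ρ(u), ant_i δ_u = ρ(u_i) and x_u is a point mass at
-- symb δ_u =: τ(u). Thus δ_u is the tuple of ρ at u, ρ is a trace of τ, accepting
-- by (iii), and as Δ_u has no repetitions μ = ρ̂.
module Submission where

open import Defs
open import Data.Nat using (ℕ; zero; suc; _+_; _≤_; s≤s; pred)
open import Data.Nat.Properties using (+-identityʳ; +-commutativeSemigroup)
open import Algebra.Properties.CommutativeSemigroup +-commutativeSemigroup using (interchange)
open import Data.Fin using (Fin; zero; suc; _≟_)
open import Data.Fin.Properties using (suc-injective)
open import Data.Fin.Subset.Properties using (_∈?_)
open import Data.Product using (∃-syntax; _×_; _,_; proj₁; proj₂)
open import Relation.Nullary using (Dec; yes; no; ¬_; contradiction)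
open import Relation.Binary.PropositionalEquality
  using (_≡_; refl; sym; trans; cong; cong₂; module ≡-Reasoning)

module _ {p} {P : Set p} where

  []·-yes : (P? : Dec P) {v : ℕ} → P → [ P? ]· v ≡ v
  []·-yes (yes _) _ = refl
  []·-yes (no ¬p) p = contradiction p ¬p

  []·-no : (P? : Dec P) {v : ℕ} → ¬ P → [ P? ]· v ≡ 0
  []·-no (yes p) ¬p = contradiction p ¬p
  []·-no (no _)  _  = refl

module _ {p q} {P : Set p} {Q : Set q} where

  []·-cong : (P? : Dec P) (Q? : Dec Q) {v : ℕ} → (P → Q) → (Q → P) →
             [ P? ]· v ≡ [ Q? ]· v
  []·-cong P? (yes q) _   p←q = []·-yes P? (p←q q)
  []·-cong P? (no ¬q) p→q _   = []·-no P? (λ p → ¬q (p→q p))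

  []·-comm : (P? : Dec P) (Q? : Dec Q) (v : ℕ) →
             [ P? ]· ([ Q? ]· v) ≡ [ Q? ]· ([ P? ]· v)
  []·-comm (yes _) Q? v = refl
  []·-comm (no _)  (yes _) v = refl
  []·-comm (no _)  (no _)  v = refl

[suc≟suc]· : ∀ {n} (i j : Fin n) (v : ℕ) → [ suc i ≟ suc j ]· v ≡ [ i ≟ j ]· v
[suc≟suc]· i j v = []·-cong (suc i ≟ suc j) (i ≟ j) suc-injective (cong suc)

[≟]·1-injective : ∀ {n} (a b : Fin n) →
                  (∀ q → [ a ≟ q ]· 1 ≡ [ b ≟ q ]· 1) → a ≡ b
[≟]·1-injective a b same with b ≟ a | trans (sym (same a)) ([]·-yes (a ≟ a) refl)
... | yes b≡a | _ = sym b≡a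
... | no _    | ()

∑-cong : ∀ n {f g : Fin n → ℕ} → (∀ i → f i ≡ g i) → ∑ n f ≡ ∑ n g
∑-cong zero    f≗g = refl
∑-cong (suc n) f≗g = cong₂ _+_ (f≗g zero) (∑-cong n (λ i → f≗g (suc i)))

∑-zero : ∀ n → ∑ n (λ _ → 0) ≡ 0
∑-zero zero    = refl
∑-zero (suc n) = ∑-zero n

∑≡0⇒≡0 : ∀ n (f : Fin n → ℕ) → ∑ n f ≡ 0 → ∀ i → f i ≡ 0
∑≡0⇒≡0 (suc n) f ∑f≡0 zero    with f zero
... | zero = refl
∑≡0⇒≡0 (suc n) f ∑f≡0 (suc i) with f zero
... | zero = ∑≡0⇒≡0 n (λ j → f (suc j)) ∑f≡0 i

∑-distrib-+ : ∀ n (f g : Fin n → ℕ) → ∑ n (λ i → f i + g i) ≡ ∑ n f + ∑ n g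
∑-distrib-+ zero    f g = refl
∑-distrib-+ (suc n) f g = begin
  f zero + g zero + ∑ n (λ i → f (suc i) + g (suc i))
    ≡⟨ cong (f zero + g zero +_) (∑-distrib-+ n (λ i → f (suc i)) (λ i → g (suc i))) ⟩
  f zero + g zero + (F + G)  ≡⟨ interchange (f zero) (g zero) F G ⟩
  f zero + F + (g zero + G)  ∎
  where
  open ≡-Reasoning
  F G : ℕ
  F = ∑ n (λ i → f (suc i))
  G = ∑ n (λ i → g (suc i))

∑-comm : ∀ n m (f : Fin n → Fin m → ℕ) →
         ∑ n (λ i → ∑ m (f i)) ≡ ∑ m (λ j → ∑ n (λ i → f i j))
∑-comm zero    m f = sym (∑-zero m)
∑-comm (suc n) m f = begin
  ∑ m (f zero) + ∑ n (λ i → ∑ m (f (suc i)))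
    ≡⟨ cong (∑ m (f zero) +_) (∑-comm n m (λ i → f (suc i))) ⟩
  ∑ m (f zero) + ∑ m (λ j → ∑ n (λ i → f (suc i) j))
    ≡⟨ sym (∑-distrib-+ m (f zero) (λ j → ∑ n (λ i → f (suc i) j))) ⟩
  ∑ m (λ j → f zero j + ∑ n (λ i → f (suc i) j))  ∎
  where open ≡-Reasoning

∑-select : ∀ n (i : Fin n) (f : Fin n → ℕ) → ∑ n (λ j → [ i ≟ j ]· f j) ≡ f i
∑-select (suc n) zero f = begin
  f zero + ∑ n (λ j → 0)  ≡⟨ cong (f zero +_) (∑-zero n) ⟩
  f zero + 0              ≡⟨ +-identityʳ (f zero) ⟩
  f zero                  ∎
  where open ≡-Reasoning
∑-select (suc n) (suc i) f = begin
  ∑ n (λ j → [ suc i ≟ suc j ]· f (suc j))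
    ≡⟨ ∑-cong n (λ j → [suc≟suc]· i j (f (suc j))) ⟩
  ∑ n (λ j → [ i ≟ j ]· f (suc j))
    ≡⟨ ∑-select n i (λ j → f (suc j)) ⟩
  f (suc i)  ∎
  where open ≡-Reasoning

∑-fibres : ∀ {k} m (D : Fin m → Fin k) (f : Fin m → ℕ) →
           ∑ k (λ q → ∑ m (λ d → [ D d ≟ q ]· f d)) ≡ ∑ m f
∑-fibres {k} m D f = begin
  ∑ k (λ q → ∑ m (λ d → [ D d ≟ q ]· f d))  ≡⟨ ∑-comm k m (λ q d → [ D d ≟ q ]· f d) ⟩
  ∑ m (λ d → ∑ k (λ q → [ D d ≟ q ]· f d))  ≡⟨ ∑-cong m (λ d → ∑-select k (D d) (λ _ → f d)) ⟩
  ∑ m f                                       ∎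
  where open ≡-Reasoning

∑-fibre-point : ∀ {k} m (D : Fin m → Fin k) (i : Fin m) (q : Fin k) →
                ∑ m (λ d → [ D d ≟ q ]· ([ i ≟ d ]· 1)) ≡ [ D i ≟ q ]· 1
∑-fibre-point m D i q = trans
  (∑-cong m (λ d → []·-comm (D d ≟ q) (i ≟ d) 1))
  (∑-select m i (λ d → [ D d ≟ q ]· 1))

∑≡1⇒point : ∀ n (f : Fin n → ℕ) → (∀ i → f i ≤ 1) → ∑ n f ≡ 1 →
            ∃[ i ] (∀ j → f j ≡ [ i ≟ j ]· 1)
∑≡1⇒point (suc n) f f≤1 ∑f≡1 with f zero in f₀ | f≤1 zero
... | zero | _ = suc i , λ { zero → f₀ ; (suc j) → trans (f-rest j) (sym ([suc≟suc]· i j 1)) }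
  where
  rest : ∃[ i ] (∀ j → f (suc j) ≡ [ i ≟ j ]· 1)
  rest = ∑≡1⇒point n (λ j → f (suc j)) (λ j → f≤1 (suc j)) ∑f≡1
  i : Fin n
  i = proj₁ rest
  f-rest : ∀ j → f (suc j) ≡ [ i ≟ j ]· 1
  f-rest = proj₂ rest
... | suc zero | _ = zero , λ { zero → f₀ ; (suc j) → ∑≡0⇒≡0 n (λ j → f (suc j)) (cong pred ∑f≡1) j }
... | suc (suc _) | s≤s ()

Node-induction : ∀ {t} (P : Node t → Set) → P root →
                 (∀ u i → P u → P (child u i)) → ∀ u → P u
Node-induction P P-root P-child root = P-root
Node-induction {node _ ch} P P-root P-child (sub j v) =
  Node-induction (λ w → P (sub j w)) (P-child root j P-root) (λ w → P-child (sub j w)) v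

module ZeroOneSolution {T : Tree} {nΣ : ℕ} (A : TreeAutomaton T nΣ) (μ : VarVec A)
                       (zero-one : ZeroOne A μ) (sol : Solves A μ) where
  open TreeAutomaton A renaming (trans to tr)
  open VarVec μ
  open Solves sol
  open Transition

  y-root-sum : ∑ (nQ root) (y root) ≡ 1
  y-root-sum = trans (∑-cong (nQ root) only-final) c-ii
    where
    only-final : ∀ q → y root q ≡ [ q ∈? F ]· y root q
    only-final q with q ∈? F
    ... | yes _   = refl
    ... | no q∉F  = c-iii q q∉F

  z-sum : ∀ u → ∑ (nQ u) (y u) ≡ 1 → ∑ (nΔ u) (z u) ≡ 1
  z-sum u ∑y≡1 = begin
    ∑ (nΔ u) (z u)
      ≡⟨ sym (∑-fibres (nΔ u) (λ d → cnq (tr u d)) (z u)) ⟩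
    ∑ (nQ u) (λ q → ∑ (nΔ u) (λ d → [ cnq (tr u d) ≟ q ]· z u d))
      ≡⟨ ∑-cong (nQ u) (c-iv u) ⟩
    ∑ (nQ u) (y u)
      ≡⟨ ∑y≡1 ⟩
    1  ∎
    where open ≡-Reasoning

  y-child-sum : ∀ u i → ∑ (nΔ u) (z u) ≡ 1 → ∑ (nQ (child u i)) (y (child u i)) ≡ 1
  y-child-sum u i ∑z≡1 = begin
    ∑ (nQ (child u i)) (y (child u i))
      ≡⟨ sym (∑-cong (nQ (child u i)) (c-v u i)) ⟩
    ∑ (nQ (child u i)) (λ q → ∑ (nΔ u) (λ d → [ ant (tr u d) i ≟ q ]· z u d))
      ≡⟨ ∑-fibres (nΔ u) (λ d → ant (tr u d) i) (z u) ⟩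
    ∑ (nΔ u) (z u)
      ≡⟨ ∑z≡1 ⟩
    1  ∎
    where open ≡-Reasoning

  y-sum : ∀ u → ∑ (nQ u) (y u) ≡ 1
  y-sum = Node-induction _ y-root-sum (λ u i ∑y≡1 → y-child-sum u i (z-sum u ∑y≡1))

  state-choice : ∀ u → ∃[ q ] (∀ q' → y u q' ≡ [ q ≟ q' ]· 1)
  state-choice u = ∑≡1⇒point (nQ u) (y u) (proj₁ (proj₂ zero-one) u) (y-sum u)

  transition-choice : ∀ u → ∃[ d ] (∀ d' → z u d' ≡ [ d ≟ d' ]· 1)
  transition-choice u = ∑≡1⇒point (nΔ u) (z u) (proj₂ (proj₂ zero-one) u) (z-sum u (y-sum u))

  ρ : TraceMap A
  ρ u = proj₁ (state-choice u)

  y≡ρ̂ : ∀ u q → y u q ≡ [ ρ u ≟ q ]· 1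
  y≡ρ̂ u = proj₂ (state-choice u)

  δ : (u : Node T) → Fin (nΔ u)
  δ u = proj₁ (transition-choice u)

  z≡δ̂ : ∀ u d → z u d ≡ [ δ u ≟ d ]· 1
  z≡δ̂ u = proj₂ (transition-choice u)

  τ : Term A
  τ u = symb (tr u (δ u))

  fibre-sum-of-z : ∀ u {k} (D : Fin (nΔ u) → Fin k) (q : Fin k) →
                   ∑ (nΔ u) (λ d → [ D d ≟ q ]· z u d) ≡ [ D (δ u) ≟ q ]· 1
  fibre-sum-of-z u D q = trans
    (∑-cong (nΔ u) (λ d → cong ([ D d ≟ q ]·_) (z≡δ̂ u d)))
    (∑-fibre-point (nΔ u) D (δ u) q)

  cnq-δ : ∀ u → cnq (tr u (δ u)) ≡ ρ u
  cnq-δ u = [≟]·1-injective _ _ λ q →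
    trans (sym (fibre-sum-of-z u (λ d → cnq (tr u d)) q)) (trans (c-iv u q) (y≡ρ̂ u q))

  ant-δ : ∀ u i → ant (tr u (δ u)) i ≡ ρ (child u i)
  ant-δ u i = [≟]·1-injective _ _ λ q →
    trans (sym (fibre-sum-of-z u (λ d → ant (tr u d) i) q)) (trans (c-v u i q) (y≡ρ̂ (child u i) q))

  δ≈tuple : ∀ u → _≈ᵗ_ T nΣ nQ (tr u (δ u)) (tupleAt A τ ρ u)
  δ≈tuple u = ant-δ u , refl , cnq-δ u

  ρ-trace : IsTrace A τ ρ
  ρ-trace u = δ u , δ≈tuple u

  y-root-ρ≡1 : y root (ρ root) ≡ 1
  y-root-ρ≡1 = trans (y≡ρ̂ root (ρ root)) ([]·-yes (ρ root ≟ ρ root) refl)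

  ρ-accepting : Accepting A ρ
  ρ-accepting with ρ root ∈? F
  ... | yes ρr∈F = ρr∈F
  ... | no ρr∉F with trans (sym (c-iii (ρ root) ρr∉F)) y-root-ρ≡1
  ...   | ()

  x≡τ̂ : ∀ u a → x u a ≡ [ τ u ≟ a ]· 1
  x≡τ̂ u a = trans (sym (c-vi u a)) (fibre-sum-of-z u (λ d → symb (tr u d)) a)

  z≡tuplê : ∀ u d → z u d ≡ [ _≈ᵗ?_ T nΣ nQ (tr u d) (tupleAt A τ ρ u) ]· 1
  z≡tuplê u d = trans (z≡δ̂ u d)
    ([]·-cong (δ u ≟ d) (_≈ᵗ?_ T nΣ nQ (tr u d) (tupleAt A τ ρ u))
      (λ { refl → δ≈tuple u })
      (λ { (ant≡ , symb≡ , cnq≡) → trans-inj u (δ u) d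
             ((λ i → trans (ant-δ u i) (sym (ant≡ i))) , sym symb≡ , trans (cnq-δ u) (sym cnq≡)) }))

  μ≐ρ̂ : _≐_ A μ (hat A τ ρ)
  μ≐ρ̂ = x≡τ̂ , y≡ρ̂ , z≡tuplê

lemma4p9 : {T : Tree} {nΣ : ℕ} (A : TreeAutomaton T nΣ) (μ : VarVec A) →
           ZeroOne A μ → Solves A μ →
           ∃[ τ ] ∃[ ρ ] (InLanguage A τ × IsTrace A τ ρ × Accepting A ρ
                          × _≐_ A μ (hat A τ ρ))
lemma4p9 A μ zero-one sol =
  τ , ρ , (ρ , ρ-trace , ρ-accepting) , ρ-trace , ρ-accepting , μ≐ρ̂
  where open ZeroOneSolution A μ zero-one sol
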